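{- Fix integers $s\ge 0$, $k,k'>0$ and $n,n'>1$. Let $G'$ be a biconnected graph with $n'$ vertices, cyclomatic number $k'$ and no external edges. Let $H$ be a $2$-edge connected graph with vertices $v_1,\ldots,v_n$, cyclomatic number $k$ and $s$ labeled external edges. Then for every $i\in\{1,\ldots,n\}$, $r_i^{G'}(H)$ is a $\mathbb{Q}$-linear combination of $2$-edge connected graphs with $n+n'-1$ vertices, cyclomatic number $k+k'$ and $s$ labeled external edges.
   Context: Graphs: a graph has a finite nonempty vertex set, a finite set of internal edges, each joining two distinct vertices (multiple edges allowed, no loops), and a finite set of external edges, each attached to exactly one vertex at one end and free at the other end; the free ends of the $s$ external edges carry distinct labels $x_1,\ldots,x_s$. A graph is connected if every pair of vertices is joined by a path of internal edges. The cyclomatic number is $m-n+c$ ($m$ internal edges, $n$ vertices, $c$ components). A graph is biconnected if it is connected and remains connected after deleting any vertex with its attached edges; $2$-edge connected if it is connected and remains connected after deleting any internal edge. A biconnected component (block) of a connected graph is a maximal biconnected subgraph. The map $r_i^{G'}$: given a connected graph $H$ with vertices $v_1,\ldots,v_n$ and a biconnected graph $G'$ with vertices $u_1,\ldots,u_{n'}$ and no external edges, let $\hat{G}$ be a copy of $G'$ in which $u_1$ is renamed $v_i$ and $u_l$ is renamed $v_{n+l-1}$ for $l=2,\ldots,n'$ (with fresh edge ends). Let $\mathcal{B}_i$ be the set of blocks of $H$ containing $v_i$, and $\mathcal{L}_i$ the set of external edges attached to $v_i$. Then $r_i^{G'}(H)$ is the sum, over all ordered partitions $(\mathcal{B}^{(1)},\ldots,\mathcal{B}^{(n')})$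 of $\mathcal{B}_i$ into $n'$ pairwise disjoint (possibly empty) subsets, and over all ways of assigning each external edge in $\mathcal{L}_i$ to a vertex of $\hat G$, of the graph obtained from $H$ by replacing the vertex $v_i$ by the graph $\hat{G}$ (adding all vertices and internal edges of $\hat{G}$), reattaching, for each $l$, the ends at $v_i$ of the internal edges belonging to blocks in $\mathcal{B}^{(l)}$ to the $l$-th vertex of $\hat{G}$ (i.e. $v_i$ if $l=1$, $v_{n+l-1}$ if $l\ge 2$), and attaching the external edges of $\mathcal{L}_i$ as assigned, keeping all other edges, incidences and labels of $H$ unchanged. It is extended linearly. -}

module Defs where

open import Data.Nat using (ℕ; zero; suc; _+_; _∸_)
open import Data.Fin using (Fin; zero; suc; _↑ˡ_; _↑ʳ_; splitAt; _≟_)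
open import Data.Fin.Subset using (Subset; _∈_)
open import Data.Integer using (ℤ; +_; _-_) renaming (_+_ to _+ℤ_)
open import Data.Product using (_×_; _,_; ∃-syntax)
open import Data.Sum using (_⊎_; inj₁; inj₂; [_,_]′)
open import Data.Unit using (⊤)
open import Relation.Nullary using (yes; no)
open import Relation.Binary.PropositionalEquality using (_≡_; _≢_)
open import Relation.Binary.Construct.Closure.ReflexiveTransitive using (Star)

-- A graph with vertex set Fin n and s external edges labelled x_1..x_s
-- (external edge j is attached to vertex ext j).  Internal edge e joins
-- src e and tgt e (multiple edges allowed; looplessness is the separate
-- predicate Loopless below).
record Graph (n s : ℕ) : Set where
  field
    m   : ℕ
    src : Fin m → Fin n
    tgt : Fin m → Fin n
    ext : Fin s → Fin n

module _ {n s : ℕ} (G : Graph n s) where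
  open Graph G

  Loopless : Set
  Loopless = ∀ e → src e ≢ tgt e

  Adj : (Fin m → Set) → Fin n → Fin n → Set
  Adj E u w = ∃[ e ] (E e × ((src e ≡ u × tgt e ≡ w) ⊎ (src e ≡ w × tgt e ≡ u)))

  ConnectedOn : (Fin n → Set) → (Fin m → Set) → Set
  ConnectedOn V E = (∃[ v ] V v) × (∀ u w → V u → V w → Star (Adj E) u w)

  IsSubgraph : (Fin n → Set) → (Fin m → Set) → Set
  IsSubgraph V E = ∀ e → E e → V (src e) × V (tgt e)

  BiconnectedOn : (Fin n → Set) → (Fin m → Set) → Set
  BiconnectedOn V E =
    ConnectedOn V E ×
    (∀ v → V v → ConnectedOn (λ u → V u × u ≢ v) (λ e → E e × (src e ≢ v × tgt e ≢ v)))

  Connected : Set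
  Connected = ConnectedOn (λ _ → ⊤) (λ _ → ⊤)

  Biconnected : Set
  Biconnected = BiconnectedOn (λ _ → ⊤) (λ _ → ⊤)

  TwoEdgeConnected : Set
  TwoEdgeConnected = Connected × (∀ e → ConnectedOn (λ _ → ⊤) (λ e' → e' ≢ e))

  SameBlock : Fin m → Fin m → Set
  SameBlock e e' =
    ∃[ V ] ∃[ E ] (IsSubgraph (_∈ V) (_∈ E) × e ∈ E × e' ∈ E × BiconnectedOn (_∈ V) (_∈ E))

  IncidentTo : Fin n → Fin m → Set
  IncidentTo v e = src e ≡ v ⊎ tgt e ≡ v

  -- cyclomatic number m - n + c for a connected graph (c = 1)
  cyclo : ℤ
  cyclo = (+ m - + n) +ℤ + 1

-- where vertex l of G' goes in the new graph: u_1 ↦ v_i, u_l ↦ v_{n+l-1}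
embG : (n : ℕ) → Fin n → {n' : ℕ} → Fin n' → Fin (n + (n' ∸ 1))
embG n i {suc p} zero    = i ↑ˡ p
embG n i {suc p} (suc l) = n ↑ʳ l

-- one summand of r_i^{G'}(H): f e is the vertex of G' to which the end at
-- v_i of an internal edge e incident to v_i is reattached (only its values on
-- edges incident to v_i matter; it must be constant on blocks), g j is the
-- vertex of G' to which external edge j is reattached if it is attached to v_i.
substitute : {n n' s : ℕ} (H : Graph n s) (i : Fin n) (G' : Graph n' 0)
  (f : Fin (Graph.m H) → Fin n') (g : Fin s → Fin n') → Graph (n + (n' ∸ 1)) s
substitute {n} {n'} H i G' f g = record
  { m   = Graph.m H + Graph.m G'
  ; src = λ x → [ (λ e → move (f e) (Graph.src H e)) , (λ e → embG n i (Graph.src G' e)) ]′ (splitAt (Graph.m H) x)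
  ; tgt = λ x → [ (λ e → move (f e) (Graph.tgt H e)) , (λ e → embG n i (Graph.tgt G' e)) ]′ (splitAt (Graph.m H) x)
  ; ext = λ j → move (g j) (Graph.ext H j)
  }
  where
  move : Fin n' → Fin n → Fin (n + (n' ∸ 1))
  move l u with u ≟ i
  ... | yes _ = embG n i l
  ... | no  _ = u ↑ˡ (n' ∸ 1)

-- The substitution adds n' - 1 vertices and the m' edges of G' and only
-- moves the ends at v_i of edges of H, so the cyclomatic numbers add up.
-- Every vertex of the result reaches the copy of G' along the image of a
-- path of H towards v_i, and the copy of G' is connected; this survives the
-- deletion of one edge as soon as H and G' are 2-edge connected.  A loopless
-- biconnected G' is: the endpoints of an edge stay connected without it,
-- through a third vertex avoiding each endpoint in turn, or, when G' has only
-- two vertices, through a parallel edge, which exists because k' > 0.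
-- The result holds for every choice of reattachment, constant on blocks or not.
module Submission where

open import Defs
open import Data.Nat using (ℕ; zero; suc; _+_; _<_; _≤_; s≤s; z≤n)
open import Data.Nat.Properties using (m≤n+m)
open import Data.Fin using (Fin; zero; suc; _↑ˡ_; _↑ʳ_; splitAt; _≟_)
open import Data.Fin.Properties
  using (splitAt-↑ˡ; splitAt-↑ʳ; splitAt⁻¹-↑ˡ; splitAt⁻¹-↑ʳ; ↑ˡ-injective; ↑ʳ-injective)
open import Data.Integer using (ℤ; +_; _-_) renaming (_+_ to _+ℤ_)
open import Data.Integer.Properties using (+-injective)
open import Data.Integer.Tactic.RingSolver using (solve-∀)
open import Data.Product using (_×_; _,_; ∃-syntax; proj₁; proj₂)
import Data.Product as Product
open import Data.Sum using (_⊎_; inj₁; inj₂; [_,_]′)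
open import Data.Unit using (⊤; tt)
open import Data.Empty using (⊥-elim)
open import Function using (_∘_)
open import Relation.Nullary using (yes; no)
open import Relation.Binary.PropositionalEquality
open import Relation.Binary.Construct.Closure.ReflexiveTransitive
  using (Star; ε; _◅_; _◅◅_; gmap; reverse; _>>=_) renaming (map to map⋆)

data SplitView (m n : ℕ) : Fin (m + n) → Set where
  left  : (x : Fin m) → SplitView m n (x ↑ˡ n)
  right : (y : Fin n) → SplitView m n (m ↑ʳ y)

splitView : ∀ m n (z : Fin (m + n)) → SplitView m n z
splitView m n z with splitAt m z in eq
... | inj₁ x = subst (SplitView m n) (splitAt⁻¹-↑ˡ eq) (left x)
... | inj₂ y = subst (SplitView m n) (splitAt⁻¹-↑ʳ eq) (right y)

↑ˡ≢↑ʳ : ∀ {m n} {x : Fin m} {y : Fin n} → x ↑ˡ n ≢ m ↑ʳ y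
↑ˡ≢↑ʳ {m} {n} {x} {y} eq
  with () ← trans (sym (splitAt-↑ˡ m x n)) (trans (cong (splitAt m) eq) (splitAt-↑ʳ m n y))

third-element : ∀ {r} (a b : Fin (3 + r)) → ∃[ c ] c ≢ a × c ≢ b
third-element zero          zero          = suc zero       , (λ ()) , (λ ())
third-element zero          (suc zero)    = suc (suc zero) , (λ ()) , (λ ())
third-element zero          (suc (suc _)) = suc zero       , (λ ()) , (λ ())
third-element (suc zero)    zero          = suc (suc zero) , (λ ()) , (λ ())
third-element (suc (suc _)) zero          = suc zero       , (λ ()) , (λ ())
third-element (suc _)       (suc _)       = zero           , (λ ()) , (λ ())

another-element : ∀ {m} → 2 ≤ m → (x : Fin m) → ∃[ y ] y ≢ x
another-element (s≤s (s≤s z≤n)) zero    = suc zero , λ ()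
another-element (s≤s (s≤s z≤n)) (suc _) = zero     , λ ()

Fin2-pairs-equal : {a b c d : Fin 2} → a ≢ b → c ≢ d → (a ≡ c × b ≡ d) ⊎ (a ≡ d × b ≡ c)
Fin2-pairs-equal {zero}     {zero}     a≢b _ = ⊥-elim (a≢b refl)
Fin2-pairs-equal {suc zero} {suc zero} a≢b _ = ⊥-elim (a≢b refl)
Fin2-pairs-equal {_} {_} {zero}     {zero}     _ c≢d = ⊥-elim (c≢d refl)
Fin2-pairs-equal {_} {_} {suc zero} {suc zero} _ c≢d = ⊥-elim (c≢d refl)
Fin2-pairs-equal {zero}     {suc zero} {zero}     {suc zero} _ _ = inj₁ (refl , refl)
Fin2-pairs-equal {zero}     {suc zero} {suc zero} {zero}     _ _ = inj₂ (refl , refl)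
Fin2-pairs-equal {suc zero} {zero}     {zero}     {suc zero} _ _ = inj₂ (refl , refl)
Fin2-pairs-equal {suc zero} {zero}     {suc zero} {zero}     _ _ = inj₁ (refl , refl)

Joins : ∀ {n s} (G : Graph n s) → Fin (Graph.m G) → Fin n → Fin n → Set
Joins G e u w = (src e ≡ u × tgt e ≡ w) ⊎ (src e ≡ w × tgt e ≡ u)
  where open Graph G

joins-map : ∀ {n n' s s'} {G : Graph n s} {G' : Graph n' s'} {e e' u w} (φ : Fin n → Fin n') →
  Graph.src G' e' ≡ φ (Graph.src G e) → Graph.tgt G' e' ≡ φ (Graph.tgt G e) →
  Joins G e u w → Joins G' e' (φ u) (φ w)
joins-map φ s t (inj₁ (refl , refl)) = inj₁ (s , t)
joins-map φ s t (inj₂ (refl , refl)) = inj₂ (s , t)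

module _ {n s} (G : Graph n s) where
  open Graph G

  Adj-sym : ∀ {E u w} → Adj G E u w → Adj G E w u
  Adj-sym (e , Ee , inj₁ uw) = e , Ee , inj₂ uw
  Adj-sym (e , Ee , inj₂ wu) = e , Ee , inj₁ wu

  connectedOn-path : ∀ {E} → ConnectedOn G (λ _ → ⊤) E → ∀ u w → Star (Adj G E) u w
  connectedOn-path (_ , conn) u w = conn u w tt tt

  non-bridge : ∀ e → Connected G → Star (Adj G (_≢ e)) (src e) (tgt e) →
    ConnectedOn G (λ _ → ⊤) (_≢ e)
  non-bridge e (v , conn) around = v , λ u w _ _ → conn u w tt tt >>= detour
    where
    detour : ∀ {u w} → Adj G (λ _ → ⊤) u w → Star (Adj G (_≢ e)) u w
    detour (e' , _ , j) with e' ≟ e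
    ... | no e'≢e = (e' , e'≢e , j) ◅ ε
    ... | yes refl with j
    ...   | inj₁ (refl , refl) = around
    ...   | inj₂ (refl , refl) = reverse Adj-sym around

  avoiding : Biconnected G → ∀ {e} v → IncidentTo G v e →
    ∀ {u w} → u ≢ v → w ≢ v → Star (Adj G (_≢ e)) u w
  avoiding (_ , cut) {e} v v∈e u≢v w≢v = map⋆ keep (proj₂ (cut v tt) _ _ (tt , u≢v) (tt , w≢v))
    where
    keep : ∀ {x y} → Adj G (λ e' → ⊤ × src e' ≢ v × tgt e' ≢ v) x y → Adj G (_≢ e) x y
    keep (e' , (_ , s≢v , t≢v) , j) = e' , (λ { refl → [ s≢v , t≢v ]′ v∈e }) , j

  positive-cyclo⇒n≤m : ∀ {k} → cyclo G ≡ + suc k → n ≤ m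
  positive-cyclo⇒n≤m {k} cyclo≡ = subst (n ≤_) (+-injective m≡) (m≤n+m n k)
    where
    shift : ∀ (K N : ℤ) → K +ℤ N ≡ ((+ 1 +ℤ K) +ℤ N) - + 1
    shift = solve-∀
    unshift : ∀ (M N : ℤ) → (((M - N) +ℤ + 1) +ℤ N) - + 1 ≡ M
    unshift = solve-∀
    m≡ : + (k + n) ≡ + m
    m≡ = begin
      + k +ℤ + n                  ≡⟨ shift (+ k) (+ n) ⟩
      (+ suc k +ℤ + n) - + 1      ≡⟨ cong (λ c → (c +ℤ + n) - + 1) (sym cyclo≡) ⟩
      (cyclo G +ℤ + n) - + 1      ≡⟨ unshift (+ m) (+ n) ⟩
      + m                         ∎
      where open ≡-Reasoning

endpoints-linked : ∀ {q s k} (G : Graph (suc (suc q)) s) → Loopless G → Biconnected G →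
  cyclo G ≡ + suc k → ∀ e → Star (Adj G (_≢ e)) (Graph.src G e) (Graph.tgt G e)
endpoints-linked {suc _} G loopless bic _ e
  with c , c≢s , c≢t ← third-element (Graph.src G e) (Graph.tgt G e) =
  avoiding G bic (Graph.tgt G e) (inj₂ refl) (loopless e) c≢t ◅◅
  avoiding G bic (Graph.src G e) (inj₁ refl) c≢s (≢-sym (loopless e))
endpoints-linked {zero} G loopless _ cyclo≡ e
  with e' , e'≢e ← another-element (positive-cyclo⇒n≤m G cyclo≡) e =
  (e' , e'≢e , Fin2-pairs-equal (loopless e') (loopless e)) ◅ ε

biconnected⇒twoEdgeConnected : ∀ {q s k} (G : Graph (suc (suc q)) s) →
  Loopless G → Biconnected G → cyclo G ≡ + suc k → TwoEdgeConnected G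
biconnected⇒twoEdgeConnected G loopless bic cyclo≡ =
  proj₁ bic , λ e → non-bridge G e (proj₁ bic) (endpoints-linked G loopless bic cyclo≡ e)

module Substitution {n p s} (H : Graph n s) (i : Fin n) (G' : Graph (suc p) 0)
  (f : Fin (Graph.m H) → Fin (suc p)) (g : Fin s → Fin (suc p)) where

  S : Graph (n + p) s
  S = substitute H i G' f g

  mH mG' : ℕ
  mH = Graph.m H
  mG' = Graph.m G'

  embed : Fin (suc p) → Fin (n + p)
  embed = embG n i

  -- the reattachment map of substitute is local to it, hence this copy
  move : Fin (suc p) → Fin n → Fin (n + p)
  move l u with u ≟ i
  ... | yes _ = embed l
  ... | no  _ = u ↑ˡ p

  move-i : ∀ {l} → move l i ≡ embed l
  move-i with i ≟ i
  ... | yes _   = refl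
  ... | no  i≢i = ⊥-elim (i≢i refl)

  move-≢ : ∀ {l u} → u ≢ i → move l u ≡ u ↑ˡ p
  move-≢ {_} {u} u≢i with u ≟ i
  ... | yes u≡i = ⊥-elim (u≢i u≡i)
  ... | no  _   = refl

  src-↑ˡ : ∀ e → Graph.src S (e ↑ˡ mG') ≡ move (f e) (Graph.src H e)
  src-↑ˡ e rewrite splitAt-↑ˡ mH e mG' with Graph.src H e ≟ i
  ... | yes _ = refl
  ... | no  _ = refl

  tgt-↑ˡ : ∀ e → Graph.tgt S (e ↑ˡ mG') ≡ move (f e) (Graph.tgt H e)
  tgt-↑ˡ e rewrite splitAt-↑ˡ mH e mG' with Graph.tgt H e ≟ i
  ... | yes _ = refl
  ... | no  _ = refl

  src-↑ʳ : ∀ e → Graph.src S (mH ↑ʳ e) ≡ embed (Graph.src G' e)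
  src-↑ʳ e rewrite splitAt-↑ʳ mH mG' e = refl

  tgt-↑ʳ : ∀ e → Graph.tgt S (mH ↑ʳ e) ≡ embed (Graph.tgt G' e)
  tgt-↑ʳ e rewrite splitAt-↑ʳ mH mG' e = refl

  joins-↑ˡ : ∀ {e u w} → Joins H e u w → Joins S (e ↑ˡ mG') (move (f e) u) (move (f e) w)
  joins-↑ˡ {e} = joins-map {G = H} {G' = S} (move (f e)) (src-↑ˡ e) (tgt-↑ˡ e)

  joins-↑ʳ : ∀ {e a b} → Joins G' e a b → Joins S (mH ↑ʳ e) (embed a) (embed b)
  joins-↑ʳ {e} = joins-map {G = G'} {G' = S} embed (src-↑ʳ e) (tgt-↑ʳ e)

  data VertexView : Fin (n + p) → Set where
    old : ∀ {u} → u ≢ i → VertexView (u ↑ˡ p)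
    new : ∀ l → VertexView (embed l)

  vertexView : ∀ w → VertexView w
  vertexView w with splitView n p w
  ... | right l = new (suc l)
  ... | left u with u ≟ i
  ...   | yes refl = new zero
  ...   | no  u≢i  = old u≢i

  embed≢↑ˡ : ∀ {l u} → u ≢ i → embed l ≢ u ↑ˡ p
  embed≢↑ˡ {zero}  u≢i eq = u≢i (sym (↑ˡ-injective p _ _ eq))
  embed≢↑ˡ {suc _} u≢i eq = ↑ˡ≢↑ʳ (sym eq)

  embed-injective : ∀ {a b} → embed a ≡ embed b → a ≡ b
  embed-injective {zero}  {zero}  _  = refl
  embed-injective {zero}  {suc _} eq = ⊥-elim (↑ˡ≢↑ʳ eq)
  embed-injective {suc _} {zero}  eq = ⊥-elim (↑ˡ≢↑ʳ (sym eq))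
  embed-injective {suc a} {suc b} eq = cong suc (↑ʳ-injective n a b eq)

  move-injective : ∀ {l u w} → u ≢ w → move l u ≢ move l w
  move-injective {l} {u} {w} u≢w with u ≟ i | w ≟ i
  ... | yes u≡i | yes w≡i = ⊥-elim (u≢w (trans u≡i (sym w≡i)))
  ... | yes _   | no  w≢i = embed≢↑ˡ {l} w≢i
  ... | no  u≢i | yes _   = embed≢↑ˡ {l} u≢i ∘ sym
  ... | no  _   | no  _   = u≢w ∘ ↑ˡ-injective p _ _

  substitute-loopless : Loopless H → Loopless G' → Loopless S
  substitute-loopless loopless-H loopless-G' x with splitView mH mG' x
  ... | left e  = λ eq → move-injective (loopless-H e) (trans (sym (src-↑ˡ e)) (trans eq (tgt-↑ˡ e)))
  ... | right e = λ eq → loopless-G' e (embed-injective (trans (sym (src-↑ʳ e)) (trans eq (tgt-↑ʳ e))))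

  module _ (Q : Fin (mH + mG') → Set) {EH : Fin mH → Set} {EG' : Fin mG' → Set}
    (EH⊆Q : ∀ e → EH e → Q (e ↑ˡ mG')) (EG'⊆Q : ∀ e → EG' e → Q (mH ↑ʳ e))
    (paths-H : ∀ u w → Star (Adj H EH) u w) (paths-G' : ∀ a b → Star (Adj G' EG') a b) where

    lift-step : ∀ {e u w} → EH e → Joins H e u w → Adj S Q (move (f e) u) (move (f e) w)
    lift-step {e} EHe j = e ↑ˡ mG' , EH⊆Q e EHe , joins-↑ˡ j

    old⇒reaches-copy : ∀ {u} → u ≢ i → Star (Adj H EH) u i → ∃[ l ] Star (Adj S Q) (u ↑ˡ p) (embed l)
    old⇒reaches-copy u≢i ε = ⊥-elim (u≢i refl)
    old⇒reaches-copy u≢i (_◅_ {j = w} (e , EHe , j) path) with w ≟ i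
    ... | yes refl = f e , subst₂ (Adj S Q) (move-≢ u≢i) move-i (lift-step EHe j) ◅ ε
    ... | no  w≢i  = Product.map₂ (subst₂ (Adj S Q) (move-≢ u≢i) (move-≢ w≢i) (lift-step EHe j) ◅_)
                                  (old⇒reaches-copy w≢i path)

    reaches-copy : ∀ w → ∃[ l ] Star (Adj S Q) w (embed l)
    reaches-copy w with vertexView w
    ... | new l       = l , ε
    ... | old {u} u≢i = old⇒reaches-copy u≢i (paths-H u i)

    paths-in-copy : ∀ a b → Star (Adj S Q) (embed a) (embed b)
    paths-in-copy a b = gmap embed (λ (e , EG'e , j) → mH ↑ʳ e , EG'⊆Q e EG'e , joins-↑ʳ j) (paths-G' a b)

    substitute-connectedOn : ConnectedOn S (λ _ → ⊤) Q
    substitute-connectedOn = (embed zero , tt) , λ w w' _ _ →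
      let (l , w⇝l) = reaches-copy w ; (l' , w'⇝l') = reaches-copy w'
      in w⇝l ◅◅ paths-in-copy l l' ◅◅ reverse (Adj-sym S) w'⇝l'

  substitute-twoEdgeConnected : TwoEdgeConnected H → TwoEdgeConnected G' → TwoEdgeConnected S
  substitute-twoEdgeConnected (conn-H , bridgeless-H) (conn-G' , bridgeless-G') =
    substitute-connectedOn _ (λ _ _ → tt) (λ _ _ → tt)
      (connectedOn-path H conn-H) (connectedOn-path G' conn-G') ,
    bridgeless
    where
    bridgeless : ∀ x → ConnectedOn S (λ _ → ⊤) (_≢ x)
    bridgeless x with splitView mH mG' x
    ... | left e  = substitute-connectedOn _
      (λ e' e'≢e → e'≢e ∘ ↑ˡ-injective mG' e' e) (λ _ _ → ↑ˡ≢↑ʳ ∘ sym)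
      (connectedOn-path H (bridgeless-H e)) (connectedOn-path G' conn-G')
    ... | right e = substitute-connectedOn _
      (λ _ _ → ↑ˡ≢↑ʳ) (λ e' e'≢e → e'≢e ∘ ↑ʳ-injective mH e' e)
      (connectedOn-path H conn-H) (connectedOn-path G' (bridgeless-G' e))

  substitute-cyclo : cyclo S ≡ cyclo H +ℤ cyclo G'
  substitute-cyclo = split (+ mH) (+ mG') (+ n) (+ p)
    where
    split : ∀ (a b c d : ℤ) →
      ((a +ℤ b) - (c +ℤ d)) +ℤ + 1 ≡ ((a - c) +ℤ + 1) +ℤ ((b - (+ 1 +ℤ d)) +ℤ + 1)
    split = solve-∀

lemma3 : (s k k' n n' : ℕ) → 0 < k → 0 < k' → 1 < n → 1 < n' →
    (G' : Graph n' 0) → Loopless G' → Biconnected G' → cyclo G' ≡ + k' →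
    (H : Graph n s) → Loopless H → TwoEdgeConnected H → cyclo H ≡ + k →
    (i : Fin n) →
    (f : Fin (Graph.m H) → Fin n') →
    (∀ e e' → IncidentTo H i e → IncidentTo H i e' → SameBlock H e e' → f e ≡ f e') →
    (g : Fin s → Fin n') →
    Loopless (substitute H i G' f g) ×
    TwoEdgeConnected (substitute H i G' f g) ×
    cyclo (substitute H i G' f g) ≡ + (k + k')
lemma3 _ _ _ _ _ _ (s≤s _) _ (s≤s (s≤s _))
       G' loopless-G' bic-G' cyclo-G' H loopless-H tec-H cyclo-H i f _ g =
  substitute-loopless loopless-H loopless-G' ,
  substitute-twoEdgeConnected tec-H (biconnected⇒twoEdgeConnected G' loopless-G' bic-G' cyclo-G') ,
  trans substitute-cyclo (cong₂ _+ℤ_ cyclo-H cyclo-G')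
  where open Substitution H i G' f g
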